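{- Assume univalence and propositional truncation. Then $B\mathsf{Aut}(\mathbf{2})\simeq\big(B\mathsf{Aut}(\mathbf{2})\simeq B\mathsf{Aut}(\mathbf{2})\big)$.
   Context: We work in intensional Martin-Löf type theory with univalent universes and propositional truncation $\|{ - }\|$. $\mathbf{2}$ is the two-element type, $B\mathsf{Aut}(\mathbf{2}):=\sum_{Z:\mathsf{Type}}\|Z=\mathbf{2}\|$, and $\simeq$ denotes the type of equivalences. -}

{-# OPTIONS --without-K #-}
module Defs where

open import Level using (Level; _⊔_; Setω) renaming (suc to lsuc; zero to lzero)
open import Data.Product using (Σ; _,_; proj₁; proj₂)
open import Data.Bool using (Bool)
open import Relation.Binary.PropositionalEquality using (_≡_; refl)

isContr : ∀ {ℓ} → Set ℓ → Set ℓ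
isContr A = Σ A λ a → (x : A) → a ≡ x

isProp : ∀ {ℓ} → Set ℓ → Set ℓ
isProp A = (x y : A) → x ≡ y

fiber : ∀ {ℓ ℓ'} {A : Set ℓ} {B : Set ℓ'} → (A → B) → B → Set (ℓ ⊔ ℓ')
fiber {A = A} f b = Σ A λ a → f a ≡ b

isEquiv : ∀ {ℓ ℓ'} {A : Set ℓ} {B : Set ℓ'} → (A → B) → Set (ℓ ⊔ ℓ')
isEquiv {B = B} f = (b : B) → isContr (fiber f b)

infix 4 _≃_
_≃_ : ∀ {ℓ ℓ'} → Set ℓ → Set ℓ' → Set (ℓ ⊔ ℓ')
A ≃ B = Σ (A → B) isEquiv

idEquiv : ∀ {ℓ} (A : Set ℓ) → A ≃ A
idEquiv A = (λ x → x) , λ b → (b , refl) , λ { (a , refl) → refl }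

idtoeqv : ∀ {ℓ} {A B : Set ℓ} → A ≡ B → A ≃ B
idtoeqv {A = A} refl = idEquiv A

Univalence : (ℓ : Level) → Set (lsuc ℓ)
Univalence ℓ = (A B : Set ℓ) → isEquiv (idtoeqv {ℓ} {A} {B})

record PropTrunc : Setω where
  field
    ∥_∥ : ∀ {ℓ} → Set ℓ → Set ℓ
    ∣_∣ : ∀ {ℓ} {A : Set ℓ} → A → ∥ A ∥
    ∥∥-isProp : ∀ {ℓ} {A : Set ℓ} → isProp ∥ A ∥
    ∥∥-ind : ∀ {ℓ ℓ'} {A : Set ℓ} (P : ∥ A ∥ → Set ℓ') →
             ((x : ∥ A ∥) → isProp (P x)) →
             ((a : A) → P ∣ a ∣) → (x : ∥ A ∥) → P x

𝟚 : Set
𝟚 = Bool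

BAut𝟚 : PropTrunc → Set (lsuc lzero)
BAut𝟚 pt = Σ Set λ Z → ∥ Z ≡ 𝟚 ∥
  where open PropTrunc pt

{-# OPTIONS --without-K #-}
module Submission where

-- The map ev : (B ≃ B) → B, e ↦ e(⋆), is an equivalence for every pointed
-- type (B, ⋆) that is connected and whose loop space Ω embeds into Bool;
-- inverting it gives B ≃ (B ≃ B).  By connectedness it suffices that the
-- fibre of ev over ⋆, the type of pointed self-equivalences (f, p), is
-- contractible, i.e. that every such (f, p) equals (id, refl).
--   * Conjugation r ↦ p⁻¹ · ap f r · p is an injective self-map of Ω fixing
--     refl; as Ω embeds into Bool it is the identity, so ap f r · p = p · r.
--   * This makes the type of homotopies f X = X coherent with p along all
--     paths ⋆ = X contractible (again by connectedness), producing a homotopy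
--     f ~ id that restricts to p at ⋆, whence (f, p) = (id, refl).

open import Defs
open import Level using (Level; zero; suc)
open import Function using (id)
open import Function.Definitions using (Injective)
open import Data.Empty using (⊥-elim)
open import Data.Product using (Σ; _,_; proj₁; proj₂)
open import Data.Bool using (Bool; true; false)
open import Data.Bool.Properties using (_≟_)
open import Relation.Nullary using (¬_; yes; no)
open import Relation.Nullary.Decidable using (map′)
open import Relation.Binary.PropositionalEquality
  using (_≡_; refl; sym; trans; cong; subst; cong-app; module ≡-Reasoning)
open import Relation.Binary.PropositionalEquality.Properties
  using (trans-reflʳ; trans-symˡ; trans-injectiveˡ; trans-injectiveʳ)
open import Axiom.UniquenessOfIdentityProofs
  using (UIP; module Constant⇒UIP; module Decidable⇒UIP)

private
  variable
    ℓ ℓ' : Level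

transpose : {A : Set ℓ} {x y z : A} (p : x ≡ y) {q : x ≡ z} {r : y ≡ z} →
  trans (sym p) q ≡ r → q ≡ trans p r
transpose refl e = e

isProp⇒UIP : {A : Set ℓ} → isProp A → UIP A
isProp⇒UIP h = Constant⇒UIP.≡-irrelevant (λ {x} {y} _ → h x y) (λ _ _ → refl)

isContr⇒isProp : {A : Set ℓ} → isContr A → isProp A
isContr⇒isProp (a , c) x y = trans (sym (c x)) (c y)

retract-isContr : {A : Set ℓ} {B : Set ℓ'} (r : B → A) (s : A → B) →
  ((a : A) → r (s a) ≡ a) → isContr B → isContr A
retract-isContr r s rs (b , c) = r b , λ a → trans (cong r (c (s a))) (rs a)

singleton-isContr : {A : Set ℓ} (a : A) → isContr (Σ A λ x → x ≡ a)
singleton-isContr a = (a , refl) , λ { (_ , refl) → refl }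

module Subtype {A : Set ℓ} {P : A → Set ℓ'} (P-prop : (a : A) → isProp (P a)) where

  Σ-path : {a a' : A} {u : P a} {u' : P a'} → a ≡ a' → _≡_ {A = Σ A P} (a , u) (a' , u')
  Σ-path {a} {u = u} {u'} refl = cong (a ,_) (P-prop a u u')

  Σ-path-proj₁ : {w w' : Σ A P} (l : w ≡ w') → Σ-path (cong proj₁ l) ≡ l
  Σ-path-proj₁ {a , u} refl = cong (cong (a ,_)) (isProp⇒UIP (P-prop a) (P-prop a u u) refl)

  proj₁-cong-injective : {w w' : Σ A P} {l l' : w ≡ w'} → cong proj₁ l ≡ cong proj₁ l' → l ≡ l'
  proj₁-cong-injective {l = l} {l'} e =
    trans (sym (Σ-path-proj₁ l)) (trans (cong Σ-path e) (Σ-path-proj₁ l'))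

module _ {A : Set ℓ} {B : Set ℓ'} {f : A → B} (f-equiv : isEquiv f) where

  private
    inverse : B → A
    inverse b = proj₁ (proj₁ (f-equiv b))

    inverse-left : (x : A) → inverse (f x) ≡ x
    inverse-left x = cong proj₁ (proj₂ (f-equiv (f x)) (x , refl))

    recover : {x y : A} → f x ≡ f y → x ≡ y
    recover {x} {y} s = trans (sym (inverse-left x)) (trans (cong inverse s) (inverse-left y))

    recover-cong : {x y : A} (r : x ≡ y) → recover (cong f r) ≡ r
    recover-cong {x} refl = trans-symˡ (inverse-left x)

  isEquiv-injective : Injective _≡_ _≡_ f
  isEquiv-injective {x} {y} q = cong proj₁ (isContr⇒isProp (f-equiv (f y)) (x , q) (y , refl))

  isEquiv-cong-injective : {x y : A} {r r' : x ≡ y} → cong f r ≡ cong f r' → r ≡ r'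
  isEquiv-cong-injective {r = r} {r'} e = begin
    r                   ≡⟨ sym (recover-cong r) ⟩
    recover (cong f r)  ≡⟨ cong recover e ⟩
    recover (cong f r') ≡⟨ recover-cong r' ⟩
    r'                  ∎
    where open ≡-Reasoning

false≢true : ¬ false ≡ true
false≢true ()

≢-same-other : {a b c : Bool} → ¬ a ≡ c → ¬ b ≡ c → a ≡ b
≢-same-other {false} {false} _ _ = refl
≢-same-other {true} {true} _ _ = refl
≢-same-other {false} {true} {false} a≢c _ = ⊥-elim (a≢c refl)
≢-same-other {false} {true} {true} _ b≢c = ⊥-elim (b≢c refl)
≢-same-other {true} {false} {true} a≢c _ = ⊥-elim (a≢c refl)
≢-same-other {true} {false} {false} _ b≢c = ⊥-elim (b≢c refl)

-- On a type embedding into Bool, an injective self-map fixing one point is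
-- the identity: a point x ≠ a₀ is sent to a point ≠ a₀, and there is only one.
injective-endo-fixes-all : {A : Set ℓ} (c : A → Bool) → Injective _≡_ _≡_ c →
  (g : A → A) → Injective _≡_ _≡_ g → {a₀ : A} → g a₀ ≡ a₀ → (x : A) → g x ≡ x
injective-endo-fixes-all c c-inj g g-inj {a₀} fix x with c x ≟ c a₀
... | yes cx≡ca₀ = trans (cong g x≡a₀) (trans fix (sym x≡a₀))
  where
  x≡a₀ : x ≡ a₀
  x≡a₀ = c-inj cx≡ca₀
... | no cx≢ca₀ = c-inj (≢-same-other cgx≢ca₀ cx≢ca₀)
  where
  cgx≢ca₀ : ¬ c (g x) ≡ c a₀
  cgx≢ca₀ e = cx≢ca₀ (cong c (g-inj (trans (c-inj e) (sym fix))))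

module FromUnivalence {ℓ} (univalence : Univalence ℓ) where

  ua : {X Y : Set ℓ} → X ≃ Y → X ≡ Y
  ua {X} {Y} e = proj₁ (proj₁ (univalence X Y e))

  ua-β : {X Y : Set ℓ} (e : X ≃ Y) → idtoeqv (ua e) ≡ e
  ua-β {X} {Y} e = proj₂ (proj₁ (univalence X Y e))

  ≃-sym : {X Y : Set ℓ} → X ≃ Y → Y ≃ X
  ≃-sym e = idtoeqv (sym (ua e))

  -- Postcomposition with an equivalence is an equivalence: by univalence it
  -- suffices to treat equivalences of the form idtoeqv q, and then q = refl.
  postcomp-isEquiv : {A X Y : Set ℓ} (e : X ≃ Y) → isEquiv (λ (h : A → X) a → proj₁ e (h a))
  postcomp-isEquiv {A} e = subst (λ e' → isEquiv (λ (h : A → _) a → proj₁ e' (h a))) (ua-β e) (along (ua e))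
    where
    along : {X Y : Set ℓ} (q : X ≡ Y) → isEquiv (λ (h : A → X) a → proj₁ (idtoeqv q) (h a))
    along {X} refl = proj₂ (idEquiv (A → X))

  -- Weak function extensionality: a product of contractible types is
  -- contractible.  It is a retract of the fibre of postcomposition with the
  -- equivalence proj₁ : Σ A P → A over id.
  Π-isContr : {A : Set ℓ} {P : A → Set ℓ} → ((x : A) → isContr (P x)) → isContr ((x : A) → P x)
  Π-isContr {A} {P} c = retract-isContr to-Π from-Π (λ _ → refl) (postcomp-isEquiv (proj₁ , proj₁-isEquiv) id)
    where
    proj₁-isEquiv : isEquiv (proj₁ {B = P})
    proj₁-isEquiv a = ((a , proj₁ (c a)) , refl) , λ { ((_ , u) , refl) → cong (λ v → (a , v) , refl) (proj₂ (c a) u) }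

    Sections : Set ℓ
    Sections = fiber (λ (h : A → Σ A P) a → proj₁ (h a)) id

    from-Π : ((x : A) → P x) → Sections
    from-Π φ = (λ x → x , φ x) , refl

    to-Π : Sections → (x : A) → P x
    to-Π (h , q) x = subst P (cong-app q x) (proj₂ (h x))

  funext : {A : Set ℓ} {P : A → Set ℓ} {f g : (x : A) → P x} → ((x : A) → f x ≡ g x) → f ≡ g
  funext {f = f} {g} h =
    cong (λ k x → proj₁ (k x)) (isContr⇒isProp (Π-isContr (λ x → singleton-isContr (f x))) (λ x → f x , refl) (λ x → g x , sym (h x)))

  Π-isProp : {A : Set ℓ} {P : A → Set ℓ} → ((x : A) → isProp (P x)) → isProp ((x : A) → P x)
  Π-isProp P-prop φ ψ = funext (λ x → P-prop x (φ x) (ψ x))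

  isContr-isProp : {A : Set ℓ} → isProp (isContr A)
  isContr-isProp (a , c) (a' , _) =
    Subtype.Σ-path (λ _ → Π-isProp (λ _ → isProp⇒UIP (isContr⇒isProp (a , c)))) (c a')

  isEquiv-isProp : {A B : Set ℓ} (f : A → B) → isProp (isEquiv f)
  isEquiv-isProp f = Π-isProp (λ _ → isContr-isProp)

module SelfEquivalences (pt : PropTrunc) {ℓ} (univalence : Univalence ℓ)
    {B : Set ℓ} (⋆ : B) (connected : (Y : B) → PropTrunc.∥_∥ pt (⋆ ≡ Y))
    (code : ⋆ ≡ ⋆ → Bool) (code-injective : Injective _≡_ _≡_ code) where

  open PropTrunc pt
  open FromUnivalence univalence

  Ω : Set ℓ
  Ω = ⋆ ≡ ⋆

  Pointed : Set ℓ
  Pointed = Σ (B → B) λ φ → φ ⋆ ≡ ⋆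

  connected-elim : (P : B → Set ℓ') → ((Y : B) → isProp (P Y)) → P ⋆ → (Y : B) → P Y
  connected-elim P P-prop P⋆ Y = ∥∥-ind (λ _ → P Y) (λ _ → P-prop Y) (λ { refl → P⋆ }) (connected Y)

  -- Ω has decidable equality through code, hence is a set (Hedberg).
  Ω-UIP : UIP Ω
  Ω-UIP = Decidable⇒UIP.≡-irrelevant (λ l l' → map′ code-injective (cong code) (code l ≟ code l'))

  paths-to-⋆-UIP : {Y : B} → Y ≡ ⋆ → UIP (Y ≡ ⋆)
  paths-to-⋆-UIP refl = Ω-UIP

  -- A pointed self-equivalence acts trivially on loops: conjugation by p
  -- is an injective self-map of Ω fixing refl, hence the identity.
  loops-commute : (f : B → B) → isEquiv f → (p : f ⋆ ≡ ⋆) → (r : Ω) → trans (cong f r) p ≡ trans p r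
  loops-commute f f-equiv p r = transpose p (injective-endo-fixes-all code code-injective conj conj-injective (trans-symˡ p) r)
    where
    conj : Ω → Ω
    conj s = trans (sym p) (trans (cong f s) p)

    conj-injective : Injective _≡_ _≡_ conj
    conj-injective e = isEquiv-cong-injective f-equiv (trans-injectiveˡ p (trans-injectiveʳ (sym p) e))

  module Rigidity (f : B → B) (p : f ⋆ ≡ ⋆) (commute : (r : Ω) → trans (cong f r) p ≡ trans p r) where

    Coherent : B → Set ℓ
    Coherent X = Σ (f X ≡ X) λ q → (r : ⋆ ≡ X) → trans (cong f r) q ≡ trans p r

    -- at ⋆ the compatibility along refl forces q = p, and compatibility is a
    -- proposition since paths f ⋆ ≡ ⋆ form a set
    Coherent-⋆-isContr : isContr (Coherent ⋆)
    Coherent-⋆-isContr = (p , commute) , λ { (q , coh) → Subtype.Σ-path coh-isProp (p≡q q (coh refl)) }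
      where
      p≡q : (q : f ⋆ ≡ ⋆) → q ≡ trans p refl → p ≡ q
      p≡q q e = trans (sym (trans-reflʳ p)) (sym e)

      coh-isProp : (q : f ⋆ ≡ ⋆) → isProp ((r : Ω) → trans (cong f r) q ≡ trans p r)
      coh-isProp q = Π-isProp (λ _ → paths-to-⋆-UIP p)

    Coherent-isContr : (X : B) → isContr (Coherent X)
    Coherent-isContr = connected-elim (λ X → isContr (Coherent X)) (λ _ → isContr-isProp) Coherent-⋆-isContr

    homotopy : (X : B) → f X ≡ X
    homotopy X = proj₁ (proj₁ (Coherent-isContr X))

    homotopy-⋆ : homotopy ⋆ ≡ p
    homotopy-⋆ = cong proj₁ (isContr⇒isProp (Coherent-isContr ⋆) (proj₁ (Coherent-isContr ⋆)) (p , commute))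

    -- (f, homotopy) is a family of based paths into each X, and the type of
    -- such families is contractible, with centre (id, refl).
    trivial : _≡_ {A = Pointed} (f , p) (id , refl)
    trivial = begin
      (f , p)                 ≡⟨ cong (f ,_) (sym homotopy-⋆) ⟩
      underlying graph        ≡⟨ cong underlying (isContr⇒isProp (Π-isContr singleton-isContr) graph diagonal) ⟩
      underlying diagonal     ∎
      where
      open ≡-Reasoning
      graph diagonal : (X : B) → Σ B λ Y → Y ≡ X
      graph X = f X , homotopy X
      diagonal X = X , refl

      underlying : ((X : B) → Σ B λ Y → Y ≡ X) → Pointed
      underlying k = (λ X → proj₁ (k X)) , proj₂ (k ⋆)

  ev : B ≃ B → B
  ev e = proj₁ e ⋆

  -- The fibre of ev over ⋆ consists of pointed self-equivalences; being an
  -- equivalence is a proposition, so such are equal if their pointed maps are.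
  pointed-equiv-path : {w w' : Pointed} → w ≡ w' → (e : isEquiv (proj₁ w)) (e' : isEquiv (proj₁ w')) →
    _≡_ {A = fiber ev ⋆} ((proj₁ w , e) , proj₂ w) ((proj₁ w' , e') , proj₂ w')
  pointed-equiv-path {w} refl e e' = cong (λ z → (proj₁ w , z) , proj₂ w) (isEquiv-isProp _ e e')

  ev-fiber-⋆-isContr : isContr (fiber ev ⋆)
  ev-fiber-⋆-isContr = (idEquiv B , refl) , λ { ((f , f-equiv) , p) →
    pointed-equiv-path (sym (Rigidity.trivial f p (loops-commute f f-equiv p))) (proj₂ (idEquiv B)) f-equiv }

  ev-isEquiv : isEquiv ev
  ev-isEquiv = connected-elim (λ Y → isContr (fiber ev Y)) (λ _ → isContr-isProp) ev-fiber-⋆-isContr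

  B≃Aut : B ≃ (B ≃ B)
  B≃Aut = ≃-sym (ev , ev-isEquiv)

module BAut𝟚-Facts (pt : PropTrunc) (ua₀ : Univalence zero) where

  open PropTrunc pt
  open FromUnivalence ua₀

  ⋆ : BAut𝟚 pt
  ⋆ = 𝟚 , ∣ refl ∣

  connected : (Y : BAut𝟚 pt) → ∥ ⋆ ≡ Y ∥
  connected (Y , t) = ∥∥-ind (λ _ → ∥ ⋆ ≡ (Y , t) ∥) (λ _ → ∥∥-isProp)
    (λ q → ∣ Subtype.Σ-path (λ _ → ∥∥-isProp) (sym q) ∣) t

  -- A self-equivalence of 𝟚 is determined by its value at true, since
  -- f false is the other Boolean.
  𝟚-equiv-determined : (e e' : 𝟚 ≃ 𝟚) → proj₁ e true ≡ proj₁ e' true → e ≡ e'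
  𝟚-equiv-determined (f , f-equiv) (f' , f'-equiv) same-true = Subtype.Σ-path isEquiv-isProp (funext agree)
    where
    agree : (b : Bool) → f b ≡ f' b
    agree true = same-true
    agree false = ≢-same-other (λ q → false≢true (isEquiv-injective f-equiv q))
                               (λ q → false≢true (isEquiv-injective f'-equiv (trans q same-true)))

  code : ⋆ ≡ ⋆ → Bool
  code l = proj₁ (idtoeqv (cong proj₁ l)) true

  code-injective : Injective _≡_ _≡_ code
  code-injective c = Subtype.proj₁-cong-injective (λ _ → ∥∥-isProp)
    (isEquiv-injective (ua₀ 𝟚 𝟚) (𝟚-equiv-determined _ _ c))

lemma8p7 : (pt : PropTrunc) → Univalence zero → Univalence (suc zero) →
    BAut𝟚 pt ≃ (BAut𝟚 pt ≃ BAut𝟚 pt)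
lemma8p7 pt ua₀ ua₁ = SelfEquivalences.B≃Aut pt ua₁ ⋆ connected code code-injective
  where
  open BAut𝟚-Facts pt ua₀
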